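{- For every formula $\varphi\in\mathcal{L}(\nabla,\bullet)$, $\vdash_{\mathbf{K4}^{\nabla\bullet}}\Delta\varphi\to\Delta\Delta\varphi\land\Delta\circ\varphi\land\circ\Delta\varphi\land\circ\circ\varphi$.
   Context: Fix a nonempty set $\mathbf{P}$ of propositional variables. $\mathcal{L}(\nabla,\bullet)$: $\varphi::=p\mid\neg\varphi\mid\varphi\land\varphi\mid\nabla\varphi\mid\bullet\varphi$ ($p\in\mathbf{P}$), with $\Delta\varphi:=\neg\nabla\varphi$, $\circ\varphi:=\neg\bullet\varphi$. The system $\mathbf{K}^{\nabla\bullet}$ has axioms: A0 all propositional tautologies; A1 $\bullet\varphi\to\varphi$; A2 $\nabla\varphi\leftrightarrow\nabla\neg\varphi$; A3 $\bullet(\psi\to\varphi)\land\varphi\to\bullet\varphi$; A4 $\nabla(\varphi\land\psi)\to\nabla\varphi\vee\nabla\psi$; A5 $\bullet(\varphi\land\psi)\to\bullet\varphi\vee\bullet\psi$; A6 $\nabla\varphi\to\bullet\varphi\vee\bullet\neg\varphi$; A7 $\bullet(\varphi\to\psi)\land\bullet(\neg\varphi\to\chi)\to\nabla\varphi$; rules: from $\varphi$ infer $\Delta\varphi$; from $\varphi$ infer $\circ\varphi$; from $\varphi\leftrightarrow\psi$ infer $\Delta\varphi\leftrightarrow\Delta\psi$ and $\circ\varphi\leftrightarrow\circ\psi$; modus ponens. $\mathbf{K4}^{\nabla\bullet}$ extends $\mathbf{K}^{\nabla\bullet}$ with: A4-1 $\Delta\varphi\to\Delta\Delta\varphi$; A4-2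 $\Delta\varphi\to\circ(\psi\to\Delta\varphi)$; A4-3 $\bullet\psi_1\land\Delta\varphi\land\circ(\neg\psi_1\to\varphi)\to\Delta\circ(\neg\psi_2\to\varphi)$; A4-4 $\bullet\psi_1\land\Delta\varphi\land\circ(\neg\psi_1\to\varphi)\to\circ(\neg\psi_1\to\circ(\neg\psi_2\to\varphi))$. -}

module Defs where

open import Data.Bool using (Bool; true; false; not; _∧_)
open import Relation.Binary.PropositionalEquality using (_≡_)

data Form (P : Set) : Set where
  var  : P → Form P
  ¬'_  : Form P → Form P
  _∧'_ : Form P → Form P → Form P
  ∇_   : Form P → Form P
  •_   : Form P → Form P

infixr 6 _∧'_
infix 8 ¬'_ ∇_ •_

module _ {P : Set} where
  infixr 6 _∨'_
  infixr 5 _→'_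
  infix 4 _↔'_
  infix 8 Δ_ ∘_

  _∨'_ : Form P → Form P → Form P
  φ ∨' ψ = ¬' (¬' φ ∧' ¬' ψ)

  _→'_ : Form P → Form P → Form P
  φ →' ψ = ¬' (φ ∧' ¬' ψ)

  _↔'_ : Form P → Form P → Form P
  φ ↔' ψ = (φ →' ψ) ∧' (ψ →' φ)

  Δ_ : Form P → Form P
  Δ φ = ¬' (∇ φ)

  ∘_ : Form P → Form P
  ∘ φ = ¬' (• φ)

  -- Propositional evaluation, where formulas ∇φ and •φ are treated as atoms
  -- (valuation v assigns truth values to all atoms: variables and modal formulas).
  record Valuation : Set where
    field
      vp : P → Bool
      vnab : Form P → Bool
      vbul : Form P → Bool

  eval : Valuation → Form P → Bool
  eval v (var p)  = Valuation.vp v p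
  eval v (¬' φ)   = not (eval v φ)
  eval v (φ ∧' ψ) = eval v φ ∧ eval v ψ
  eval v (∇ φ)    = Valuation.vnab v φ
  eval v (• φ)    = Valuation.vbul v φ

  Tautology : Form P → Set
  Tautology φ = (v : Valuation) → eval v φ ≡ true

  data ⊢K4 : Form P → Set where
    A0   : ∀ {φ} → Tautology φ → ⊢K4 φ
    A1   : ∀ φ → ⊢K4 (• φ →' φ)
    A2   : ∀ φ → ⊢K4 (∇ φ ↔' ∇ (¬' φ))
    A3   : ∀ φ ψ → ⊢K4 ((• (ψ →' φ) ∧' φ) →' • φ)
    A4   : ∀ φ ψ → ⊢K4 (∇ (φ ∧' ψ) →' (∇ φ ∨' ∇ ψ))
    A5   : ∀ φ ψ → ⊢K4 (• (φ ∧' ψ) →' (• φ ∨' • ψ))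
    A6   : ∀ φ → ⊢K4 (∇ φ →' (• φ ∨' • (¬' φ)))
    A7   : ∀ φ ψ χ → ⊢K4 ((• (φ →' ψ) ∧' • (¬' φ →' χ)) →' ∇ φ)
    A4-1 : ∀ φ → ⊢K4 (Δ φ →' Δ Δ φ)
    A4-2 : ∀ φ ψ → ⊢K4 (Δ φ →' ∘ (ψ →' Δ φ))
    A4-3 : ∀ φ ψ₁ ψ₂ →
      ⊢K4 (((• ψ₁ ∧' Δ φ) ∧' ∘ (¬' ψ₁ →' φ)) →' Δ (∘ (¬' ψ₂ →' φ)))
    A4-4 : ∀ φ ψ₁ ψ₂ →
      ⊢K4 (((• ψ₁ ∧' Δ φ) ∧' ∘ (¬' ψ₁ →' φ)) →' ∘ (¬' ψ₁ →' ∘ (¬' ψ₂ →' φ)))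
    NEC∇ : ∀ {φ} → ⊢K4 φ → ⊢K4 (Δ φ)
    NEC• : ∀ {φ} → ⊢K4 φ → ⊢K4 (∘ φ)
    RE∇  : ∀ {φ ψ} → ⊢K4 (φ ↔' ψ) → ⊢K4 (Δ φ ↔' Δ ψ)
    RE•  : ∀ {φ ψ} → ⊢K4 (φ ↔' ψ) → ⊢K4 (∘ φ ↔' ∘ ψ)
    MP   : ∀ {φ ψ} → ⊢K4 (φ →' ψ) → ⊢K4 φ → ⊢K4 ψ

{-# OPTIONS --safe #-}
-- ΔΔφ and ∘Δφ are axioms A4-1 and A4-2. The other two conjuncts follow by case
-- analysis on •φ: ∘∘φ from A4-4 and A3 applied to ψ = φ ∧ ∘φ and to ψ = ¬φ; Δ∘φ from
-- A4, A6 and A7 when •φ, and from A6 together with ∘∘φ when ∘φ. All remaining reasoning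
-- is propositional over modal atoms and is checked by truth tables.
module Submission where

open import Data.Bool using (Bool; true; false; not; _∧_; T)
open import Data.Bool.Properties using (T-∧; T-≡)
open import Data.Fin using (Fin)
open import Data.List using (List; []; _∷_)
open import Data.List.Relation.Unary.All using (All; []; _∷_)
open import Data.Nat using (ℕ; zero; suc)
open import Data.Product using (proj₁; proj₂)
open import Data.Vec using (Vec; []; _∷_; lookup; map; tabulate)
open import Data.Vec.Properties using (lookup-map)
open import Function.Bundles using (Equivalence)
open import Relation.Binary.PropositionalEquality using (_≡_; sym; trans; cong; cong₂)

open import Defs

open Equivalence using (to)

data PForm (n : ℕ) : Set where
  atom : Fin n → PForm n
  ¬ᵖ_  : PForm n → PForm n
  _∧ᵖ_ : PForm n → PForm n → PForm n

infixr 6 _∧ᵖ_ _∨ᵖ_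
infixr 5 _→ᵖ_
infix 4 _↔ᵖ_
infix 8 ¬ᵖ_

_∨ᵖ_ _→ᵖ_ _↔ᵖ_ : ∀ {n} → PForm n → PForm n → PForm n
A ∨ᵖ B = ¬ᵖ (¬ᵖ A ∧ᵖ ¬ᵖ B)
A →ᵖ B = ¬ᵖ (A ∧ᵖ ¬ᵖ B)
A ↔ᵖ B = (A →ᵖ B) ∧ᵖ (B →ᵖ A)

⟦_⟧ : ∀ {n} → PForm n → Vec Bool n → Bool
⟦ atom i ⟧ ρ = lookup ρ i
⟦ ¬ᵖ A ⟧   ρ = not (⟦ A ⟧ ρ)
⟦ A ∧ᵖ B ⟧ ρ = ⟦ A ⟧ ρ ∧ ⟦ B ⟧ ρ

_⇛_ : ∀ {n} → List (PForm n) → PForm n → PForm n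
[]      ⇛ C = C
(A ∷ Γ) ⇛ C = A →ᵖ (Γ ⇛ C)

∀ᵇ : (n : ℕ) → (Vec Bool n → Bool) → Bool
∀ᵇ zero    f = f []
∀ᵇ (suc n) f = ∀ᵇ n (λ ρ → f (true ∷ ρ)) ∧ ∀ᵇ n (λ ρ → f (false ∷ ρ))

∀ᵇ-sound : ∀ n (f : Vec Bool n → Bool) → T (∀ᵇ n f) → ∀ ρ → T (f ρ)
∀ᵇ-sound zero    f h []          = h
∀ᵇ-sound (suc n) f h (true ∷ ρ)  = ∀ᵇ-sound n _ (proj₁ (T-∧ .to h)) ρ
∀ᵇ-sound (suc n) f h (false ∷ ρ) = ∀ᵇ-sound n _ (proj₂ (T-∧ .to h)) ρ

Valid : ∀ {n} → PForm n → Set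
Valid {n} A = T (∀ᵇ n ⟦ A ⟧)

infix 3 _⊢ᵖ_

record Inference (n : ℕ) : Set where
  constructor _⊢ᵖ_
  field
    premises   : List (PForm n)
    conclusion : PForm n

open Inference

module _ {P : Set} where

  instantiate : ∀ {n} → Vec (Form P) n → PForm n → Form P
  instantiate σ (atom i) = lookup σ i
  instantiate σ (¬ᵖ A)   = ¬' instantiate σ A
  instantiate σ (A ∧ᵖ B) = instantiate σ A ∧' instantiate σ B

  eval-instantiate : ∀ {n} (v : Valuation) (σ : Vec (Form P) n) (A : PForm n) →
    eval v (instantiate σ A) ≡ ⟦ A ⟧ (map (eval v) σ)
  eval-instantiate v σ (atom i) = sym (lookup-map i (eval v) σ)
  eval-instantiate v σ (¬ᵖ A)   = cong not (eval-instantiate v σ A)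
  eval-instantiate v σ (A ∧ᵖ B) = cong₂ _∧_ (eval-instantiate v σ A) (eval-instantiate v σ B)

  valid⇒⊢ : ∀ {n} (σ : Vec (Form P) n) (A : PForm n) → Valid A → ⊢K4 (instantiate σ A)
  valid⇒⊢ {n} σ A valid = A0 λ v →
    trans (eval-instantiate v σ A) (T-≡ .to (∀ᵇ-sound n ⟦ A ⟧ valid (map (eval v) σ)))

  mp* : ∀ {n} (σ : Vec (Form P) n) (Γ : List (PForm n)) {C : PForm n} →
    ⊢K4 (instantiate σ (Γ ⇛ C)) → All (λ A → ⊢K4 (instantiate σ A)) Γ → ⊢K4 (instantiate σ C)
  mp* σ []      ⊢C  []         = ⊢C
  mp* σ (A ∷ Γ) ⊢ΓC (⊢A ∷ ⊢Γ) = mp* σ Γ (MP ⊢ΓC ⊢A) ⊢Γ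

  -- The atoms of R are bound positionally to the formulas in σ; the implicit
  -- validity argument is found by computing the truth table.
  byTautology : ∀ {n} (σ : Vec (Form P) n) (R : Vec (PForm n) n → Inference n) →
    let I = R (tabulate atom) in
    {_ : Valid (premises I ⇛ conclusion I)} →
    All (λ A → ⊢K4 (instantiate σ A)) (premises I) → ⊢K4 (instantiate σ (conclusion I))
  byTautology σ R {valid} = mp* σ (premises I) (valid⇒⊢ σ (premises I ⇛ conclusion I) valid)
    where I = R (tabulate atom)

  ¬→self↔self : (φ : Form P) → ⊢K4 ((¬' φ →' φ) ↔' φ)
  ¬→self↔self φ = byTautology (φ ∷ []) (λ { (⌜φ⌝ ∷ []) →
    [] ⊢ᵖ (¬ᵖ ⌜φ⌝ →ᵖ ⌜φ⌝) ↔ᵖ ⌜φ⌝ }) []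

  •∧•→⇒∇ : (φ ψ : Form P) → ⊢K4 ((• φ ∧' • (φ →' ψ)) →' ∇ φ)
  •∧•→⇒∇ φ ψ = byTautology (• φ ∷ • (φ →' ψ) ∷ • (¬' φ →' φ) ∷ ∇ φ ∷ [])
    (λ { (⌜•φ⌝ ∷ ⌜•[φ→ψ]⌝ ∷ ⌜•[¬φ→φ]⌝ ∷ ⌜∇φ⌝ ∷ []) →
      (⌜•[φ→ψ]⌝ ∧ᵖ ⌜•[¬φ→φ]⌝ →ᵖ ⌜∇φ⌝) ∷ (¬ᵖ ⌜•[¬φ→φ]⌝ ↔ᵖ ¬ᵖ ⌜•φ⌝) ∷ []
      ⊢ᵖ ⌜•φ⌝ ∧ᵖ ⌜•[φ→ψ]⌝ →ᵖ ⌜∇φ⌝ })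
    (A7 φ ψ φ ∷ RE• (¬→self↔self φ) ∷ [])

  Δ∧∇→⇒∇ : (φ ψ : Form P) → ⊢K4 ((Δ φ ∧' ∇ (φ →' ψ)) →' ∇ ψ)
  Δ∧∇→⇒∇ φ ψ = byTautology (∇ φ ∷ ∇ (φ →' ψ) ∷ ∇ (φ ∧' ¬' ψ) ∷ ∇ ψ ∷ ∇ (¬' ψ) ∷ [])
    (λ { (⌜∇φ⌝ ∷ ⌜∇[φ→ψ]⌝ ∷ ⌜∇[φ∧¬ψ]⌝ ∷ ⌜∇ψ⌝ ∷ ⌜∇¬ψ⌝ ∷ []) →
      (⌜∇[φ∧¬ψ]⌝ ↔ᵖ ⌜∇[φ→ψ]⌝) ∷ (⌜∇[φ∧¬ψ]⌝ →ᵖ ⌜∇φ⌝ ∨ᵖ ⌜∇¬ψ⌝) ∷ (⌜∇ψ⌝ ↔ᵖ ⌜∇¬ψ⌝) ∷ []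
      ⊢ᵖ ¬ᵖ ⌜∇φ⌝ ∧ᵖ ⌜∇[φ→ψ]⌝ →ᵖ ⌜∇ψ⌝ })
    (A2 (φ ∧' ¬' ψ) ∷ A4 φ (¬' ψ) ∷ A2 ψ ∷ [])

  -- With χ = φ ∧ ∘φ we have ¬χ = φ → •φ, and ∇∘φ is ∇(φ → χ) up to A1.
  Δ∧•⇒Δ∘ : (φ : Form P) → ⊢K4 ((Δ φ ∧' • φ) →' Δ ∘ φ)
  Δ∧•⇒Δ∘ φ = byTautology
    (φ ∷ • φ ∷ ∇ φ ∷ ∇ ∘ φ ∷ ∇ (φ →' χ) ∷ ∇ χ ∷ • χ ∷ • (¬' χ) ∷ [])
    (λ { (⌜φ⌝ ∷ ⌜•φ⌝ ∷ ⌜∇φ⌝ ∷ ⌜∇∘φ⌝ ∷ ⌜∇[φ→χ]⌝ ∷ ⌜∇χ⌝ ∷ ⌜•χ⌝ ∷ ⌜•¬χ⌝ ∷ []) →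
      (¬ᵖ ⌜∇[φ→χ]⌝ ↔ᵖ ¬ᵖ ⌜∇∘φ⌝) ∷ (¬ᵖ ⌜∇φ⌝ ∧ᵖ ⌜∇[φ→χ]⌝ →ᵖ ⌜∇χ⌝) ∷
      (⌜∇χ⌝ →ᵖ ⌜•χ⌝ ∨ᵖ ⌜•¬χ⌝) ∷ (⌜•χ⌝ →ᵖ ⌜φ⌝ ∧ᵖ ¬ᵖ ⌜•φ⌝) ∷ (⌜•φ⌝ ∧ᵖ ⌜•¬χ⌝ →ᵖ ⌜∇φ⌝) ∷ []
      ⊢ᵖ ¬ᵖ ⌜∇φ⌝ ∧ᵖ ⌜•φ⌝ →ᵖ ¬ᵖ ⌜∇∘φ⌝ })
    (RE∇ φ→χ↔∘φ ∷ Δ∧∇→⇒∇ φ χ ∷ A6 χ ∷ A1 χ ∷ •∧•→⇒∇ φ (• φ) ∷ [])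
    where
    χ : Form P
    χ = φ ∧' ∘ φ

    φ→χ↔∘φ : ⊢K4 ((φ →' χ) ↔' ∘ φ)
    φ→χ↔∘φ = byTautology (φ ∷ • φ ∷ []) (λ { (⌜φ⌝ ∷ ⌜•φ⌝ ∷ []) →
      (⌜•φ⌝ →ᵖ ⌜φ⌝) ∷ [] ⊢ᵖ (⌜φ⌝ →ᵖ ⌜φ⌝ ∧ᵖ ¬ᵖ ⌜•φ⌝) ↔ᵖ ¬ᵖ ⌜•φ⌝ }) (A1 φ ∷ [])

  -- Split on •ψ: if •ψ, axiom A4-4 applies; otherwise A3 with antecedent ¬∘φ.
  -- In both cases ψ → ∘φ collapses the resulting ∘(…) to ∘∘φ.
  Δ∧ψ⇒∘∘ : {φ ψ : Form P} → ⊢K4 (ψ →' ∘ φ) → ⊢K4 (ψ →' ∘ (¬' ψ →' φ)) →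
    ⊢K4 ((Δ φ ∧' ψ) →' ∘ ∘ φ)
  Δ∧ψ⇒∘∘ {φ} {ψ} ψ⇒∘φ ψ⇒∘[¬ψ→φ] = byTautology
    (ψ ∷ ∇ φ ∷ • ψ ∷ • (¬' ψ →' φ) ∷ • (¬' ψ →' ∘ (¬' φ →' φ)) ∷ • ∘ φ ∷ • (¬' ∘ φ →' ψ) ∷ [])
    (λ { (⌜ψ⌝ ∷ ⌜∇φ⌝ ∷ ⌜•ψ⌝ ∷ ⌜•[¬ψ→φ]⌝ ∷ ⌜•[¬ψ→∘[¬φ→φ]]⌝ ∷ ⌜•∘φ⌝ ∷ ⌜•[¬∘φ→ψ]⌝ ∷ []) →
      (⌜ψ⌝ →ᵖ ¬ᵖ ⌜•[¬ψ→φ]⌝) ∷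
      ((⌜•ψ⌝ ∧ᵖ ¬ᵖ ⌜∇φ⌝) ∧ᵖ ¬ᵖ ⌜•[¬ψ→φ]⌝ →ᵖ ¬ᵖ ⌜•[¬ψ→∘[¬φ→φ]]⌝) ∷
      (¬ᵖ ⌜•[¬ψ→∘[¬φ→φ]]⌝ ↔ᵖ ¬ᵖ ⌜•∘φ⌝) ∷
      (⌜•[¬∘φ→ψ]⌝ ∧ᵖ ⌜ψ⌝ →ᵖ ⌜•ψ⌝) ∷
      (¬ᵖ ⌜•[¬∘φ→ψ]⌝ ↔ᵖ ¬ᵖ ⌜•∘φ⌝) ∷ []
      ⊢ᵖ ¬ᵖ ⌜∇φ⌝ ∧ᵖ ⌜ψ⌝ →ᵖ ¬ᵖ ⌜•∘φ⌝ })
    (ψ⇒∘[¬ψ→φ] ∷ A4-4 φ ψ φ ∷ RE• ¬ψ→∘[¬φ→φ]↔∘φ ∷ A3 ψ (¬' ∘ φ) ∷ RE• ¬∘φ→ψ↔∘φ ∷ [])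
    where
    ¬ψ→∘[¬φ→φ]↔∘φ : ⊢K4 ((¬' ψ →' ∘ (¬' φ →' φ)) ↔' ∘ φ)
    ¬ψ→∘[¬φ→φ]↔∘φ = byTautology (ψ ∷ • φ ∷ • (¬' φ →' φ) ∷ [])
      (λ { (⌜ψ⌝ ∷ ⌜•φ⌝ ∷ ⌜•[¬φ→φ]⌝ ∷ []) →
        (⌜ψ⌝ →ᵖ ¬ᵖ ⌜•φ⌝) ∷ (¬ᵖ ⌜•[¬φ→φ]⌝ ↔ᵖ ¬ᵖ ⌜•φ⌝) ∷ []
        ⊢ᵖ (¬ᵖ ⌜ψ⌝ →ᵖ ¬ᵖ ⌜•[¬φ→φ]⌝) ↔ᵖ ¬ᵖ ⌜•φ⌝ })
      (ψ⇒∘φ ∷ RE• (¬→self↔self φ) ∷ [])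

    ¬∘φ→ψ↔∘φ : ⊢K4 ((¬' ∘ φ →' ψ) ↔' ∘ φ)
    ¬∘φ→ψ↔∘φ = byTautology (ψ ∷ • φ ∷ []) (λ { (⌜ψ⌝ ∷ ⌜•φ⌝ ∷ []) →
      (⌜ψ⌝ →ᵖ ¬ᵖ ⌜•φ⌝) ∷ [] ⊢ᵖ (¬ᵖ ¬ᵖ ⌜•φ⌝ →ᵖ ⌜ψ⌝) ↔ᵖ ¬ᵖ ⌜•φ⌝ }) (ψ⇒∘φ ∷ [])

  Δ⇒∘∘ : (φ : Form P) → ⊢K4 (Δ φ →' ∘ ∘ φ)
  Δ⇒∘∘ φ = byTautology (φ ∷ • φ ∷ ∇ φ ∷ • ∘ φ ∷ [])
    (λ { (⌜φ⌝ ∷ ⌜•φ⌝ ∷ ⌜∇φ⌝ ∷ ⌜•∘φ⌝ ∷ []) →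
      (⌜•∘φ⌝ →ᵖ ¬ᵖ ⌜•φ⌝) ∷
      (¬ᵖ ⌜∇φ⌝ ∧ᵖ ⌜φ⌝ ∧ᵖ ¬ᵖ ⌜•φ⌝ →ᵖ ¬ᵖ ⌜•∘φ⌝) ∷
      (¬ᵖ ⌜∇φ⌝ ∧ᵖ ¬ᵖ ⌜φ⌝ →ᵖ ¬ᵖ ⌜•∘φ⌝) ∷ []
      ⊢ᵖ ¬ᵖ ⌜∇φ⌝ →ᵖ ¬ᵖ ⌜•∘φ⌝ })
    (A1 (∘ φ) ∷ Δ∧ψ⇒∘∘ χ⇒∘φ χ⇒∘[¬χ→φ] ∷ Δ∧ψ⇒∘∘ ¬φ⇒∘φ ¬φ⇒∘[¬¬φ→φ] ∷ [])
    where
    χ : Form P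
    χ = φ ∧' ∘ φ

    χ⇒∘φ : ⊢K4 (χ →' ∘ φ)
    χ⇒∘φ = byTautology (φ ∷ • φ ∷ []) (λ { (⌜φ⌝ ∷ ⌜•φ⌝ ∷ []) →
      [] ⊢ᵖ ⌜φ⌝ ∧ᵖ ¬ᵖ ⌜•φ⌝ →ᵖ ¬ᵖ ⌜•φ⌝ }) []

    χ⇒∘[¬χ→φ] : ⊢K4 (χ →' ∘ (¬' χ →' φ))
    χ⇒∘[¬χ→φ] = byTautology (φ ∷ • φ ∷ • (¬' χ →' φ) ∷ [])
      (λ { (⌜φ⌝ ∷ ⌜•φ⌝ ∷ ⌜•[¬χ→φ]⌝ ∷ []) →
        (⌜•[¬χ→φ]⌝ ∧ᵖ ⌜φ⌝ →ᵖ ⌜•φ⌝) ∷ [] ⊢ᵖ ⌜φ⌝ ∧ᵖ ¬ᵖ ⌜•φ⌝ →ᵖ ¬ᵖ ⌜•[¬χ→φ]⌝ })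
      (A3 φ (¬' χ) ∷ [])

    ¬φ⇒∘φ : ⊢K4 (¬' φ →' ∘ φ)
    ¬φ⇒∘φ = byTautology (φ ∷ • φ ∷ []) (λ { (⌜φ⌝ ∷ ⌜•φ⌝ ∷ []) →
      (⌜•φ⌝ →ᵖ ⌜φ⌝) ∷ [] ⊢ᵖ ¬ᵖ ⌜φ⌝ →ᵖ ¬ᵖ ⌜•φ⌝ }) (A1 φ ∷ [])

    ¬φ⇒∘[¬¬φ→φ] : ⊢K4 (¬' φ →' ∘ (¬' ¬' φ →' φ))
    ¬φ⇒∘[¬¬φ→φ] = byTautology (φ ∷ • (¬' ¬' φ →' φ) ∷ [])
      (λ { (⌜φ⌝ ∷ ⌜•[¬¬φ→φ]⌝ ∷ []) →
        ¬ᵖ ⌜•[¬¬φ→φ]⌝ ∷ [] ⊢ᵖ ¬ᵖ ⌜φ⌝ →ᵖ ¬ᵖ ⌜•[¬¬φ→φ]⌝ })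
      (NEC• (byTautology (φ ∷ []) (λ { (⌜φ⌝ ∷ []) → [] ⊢ᵖ ¬ᵖ ¬ᵖ ⌜φ⌝ →ᵖ ⌜φ⌝ }) []) ∷ [])

  ∘∧∘∘⇒Δ∘ : (φ : Form P) → ⊢K4 ((∘ φ ∧' ∘ ∘ φ) →' Δ ∘ φ)
  ∘∧∘∘⇒Δ∘ φ = byTautology (• φ ∷ • ∘ φ ∷ • • φ ∷ ∇ ∘ φ ∷ • (¬' ∘ φ) ∷ [])
    (λ { (⌜•φ⌝ ∷ ⌜•∘φ⌝ ∷ ⌜••φ⌝ ∷ ⌜∇∘φ⌝ ∷ ⌜•¬∘φ⌝ ∷ []) →
      (⌜∇∘φ⌝ →ᵖ ⌜•∘φ⌝ ∨ᵖ ⌜•¬∘φ⌝) ∷ (⌜••φ⌝ →ᵖ ⌜•φ⌝) ∷ (¬ᵖ ⌜•¬∘φ⌝ ↔ᵖ ¬ᵖ ⌜••φ⌝) ∷ []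
      ⊢ᵖ ¬ᵖ ⌜•φ⌝ ∧ᵖ ¬ᵖ ⌜•∘φ⌝ →ᵖ ¬ᵖ ⌜∇∘φ⌝ })
    (A6 (∘ φ) ∷ A1 (• φ) ∷ RE• ¬¬•φ↔•φ ∷ [])
    where
    ¬¬•φ↔•φ : ⊢K4 (¬' ∘ φ ↔' • φ)
    ¬¬•φ↔•φ = byTautology (• φ ∷ []) (λ { (⌜•φ⌝ ∷ []) → [] ⊢ᵖ ¬ᵖ ¬ᵖ ⌜•φ⌝ ↔ᵖ ⌜•φ⌝ }) []

  Δ⇒Δ∘ : (φ : Form P) → ⊢K4 (Δ φ →' Δ ∘ φ)
  Δ⇒Δ∘ φ = byTautology (• φ ∷ ∇ φ ∷ • ∘ φ ∷ ∇ ∘ φ ∷ [])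
    (λ { (⌜•φ⌝ ∷ ⌜∇φ⌝ ∷ ⌜•∘φ⌝ ∷ ⌜∇∘φ⌝ ∷ []) →
      (¬ᵖ ⌜∇φ⌝ ∧ᵖ ⌜•φ⌝ →ᵖ ¬ᵖ ⌜∇∘φ⌝) ∷ (¬ᵖ ⌜∇φ⌝ →ᵖ ¬ᵖ ⌜•∘φ⌝) ∷
      (¬ᵖ ⌜•φ⌝ ∧ᵖ ¬ᵖ ⌜•∘φ⌝ →ᵖ ¬ᵖ ⌜∇∘φ⌝) ∷ []
      ⊢ᵖ ¬ᵖ ⌜∇φ⌝ →ᵖ ¬ᵖ ⌜∇∘φ⌝ })
    (Δ∧•⇒Δ∘ φ ∷ Δ⇒∘∘ φ ∷ ∘∧∘∘⇒Δ∘ φ ∷ [])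

  Δ⇒∘Δ : (φ : Form P) → ⊢K4 (Δ φ →' ∘ Δ φ)
  Δ⇒∘Δ φ = byTautology (∇ φ ∷ • (⊤ →' Δ φ) ∷ • Δ φ ∷ [])
    (λ { (⌜∇φ⌝ ∷ ⌜•[⊤→Δφ]⌝ ∷ ⌜•Δφ⌝ ∷ []) →
      (¬ᵖ ⌜∇φ⌝ →ᵖ ¬ᵖ ⌜•[⊤→Δφ]⌝) ∷ (¬ᵖ ⌜•[⊤→Δφ]⌝ ↔ᵖ ¬ᵖ ⌜•Δφ⌝) ∷ []
      ⊢ᵖ ¬ᵖ ⌜∇φ⌝ →ᵖ ¬ᵖ ⌜•Δφ⌝ })
    (A4-2 φ ⊤ ∷ RE• ⊤→Δφ↔Δφ ∷ [])
    where
    ⊤ : Form P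
    ⊤ = φ →' φ

    ⊤→Δφ↔Δφ : ⊢K4 ((⊤ →' Δ φ) ↔' Δ φ)
    ⊤→Δφ↔Δφ = byTautology (φ ∷ ∇ φ ∷ []) (λ { (⌜φ⌝ ∷ ⌜∇φ⌝ ∷ []) →
      [] ⊢ᵖ ((⌜φ⌝ →ᵖ ⌜φ⌝) →ᵖ ¬ᵖ ⌜∇φ⌝) ↔ᵖ ¬ᵖ ⌜∇φ⌝ }) []

mainTheorem13 : {P : Set} → P → (φ : Form P) →
    ⊢K4 (Δ φ →' (((Δ Δ φ ∧' Δ ∘ φ) ∧' ∘ Δ φ) ∧' ∘ ∘ φ))
mainTheorem13 _ φ = byTautology (∇ φ ∷ ∇ Δ φ ∷ ∇ ∘ φ ∷ • Δ φ ∷ • ∘ φ ∷ [])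
  (λ { (⌜∇φ⌝ ∷ ⌜∇Δφ⌝ ∷ ⌜∇∘φ⌝ ∷ ⌜•Δφ⌝ ∷ ⌜•∘φ⌝ ∷ []) →
    (¬ᵖ ⌜∇φ⌝ →ᵖ ¬ᵖ ⌜∇Δφ⌝) ∷ (¬ᵖ ⌜∇φ⌝ →ᵖ ¬ᵖ ⌜∇∘φ⌝) ∷
    (¬ᵖ ⌜∇φ⌝ →ᵖ ¬ᵖ ⌜•Δφ⌝) ∷ (¬ᵖ ⌜∇φ⌝ →ᵖ ¬ᵖ ⌜•∘φ⌝) ∷ []
    ⊢ᵖ ¬ᵖ ⌜∇φ⌝ →ᵖ ((¬ᵖ ⌜∇Δφ⌝ ∧ᵖ ¬ᵖ ⌜∇∘φ⌝) ∧ᵖ ¬ᵖ ⌜•Δφ⌝) ∧ᵖ ¬ᵖ ⌜•∘φ⌝ })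
  (A4-1 φ ∷ Δ⇒Δ∘ φ ∷ Δ⇒∘Δ φ ∷ Δ⇒∘∘ φ ∷ [])
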